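{- For any integer $k\geq 1$, the mappings $h\colon L_{2k,k+1}\to L_{2k,k}\setminus D_{2k}^0$ and $g'\colon L_{2k,k}\setminus D_{2k}^0\to L_{2k,k+1}$ are bijections, and $h^{ -1}=g'$.
   Context: A lattice path with $n$ steps is a sequence $x=(x_1,\ldots,x_n)$ of steps, each either an up-step $(1,1)$ or a down-step $(1,-1)$, drawn in $\mathbb{Z}^2$ starting at the origin; step $x_i$ goes from $(i-1,h_{i-1})$ to $(i,h_i)$. A step lies below the line $y=c$ if both of its endpoints have $y$-coordinate at most $c$. A step touches the line $y=c$ if it starts or ends on that line. For $c\in\mathbb{Z}$, $u_c(x)$ and $d_c(x)$ denote the number of up-steps, respectively down-steps, of $x$ that start on the line $y=c$. Let $L_{2k,k}$ (resp. $L_{2k,k+1}$) be the set of lattice paths with $2k$ steps of which exactly $k$ (resp. $k+1$) are up-steps. For $e\in\{0,\ldots,k\}$, $D_{2k}^e$ is the set of paths in $L_{2k,k}$ having exactly $e$ down-steps below the line $y=0$. For $x\in L_{2k,k+1}$, $h(x)$ is obtained from $x$ by replacing by a down-step the $u_1(x)$-th (from the left) up-step of $x$ touching the line $y=1$. For $x\in L_{2k,k}\setminus D_{2k}^0$, $g'(x)$ is obtained from $x$ by replacing by an up-step the $d_0(x)$-th (from the left) down-step of $x$ touching the line $y=0$. -}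

module Defs where

open import Data.Bool using (Bool; true; false; if_then_else_; _∧_; _∨_)
open import Data.Nat using (ℕ; zero; suc; _+_; _*_)
open import Data.Integer using (ℤ; +_; -[1+_]) renaming (_+_ to _+ℤ_; _-_ to _-ℤ_)
import Data.Integer as ℤ
open import Data.Vec using (Vec; []; _∷_)
open import Relation.Nullary.Decidable using (⌊_⌋)
open import Relation.Binary.PropositionalEquality using (_≡_)
open import Relation.Nullary using (¬_)
open import Data.Product using (_×_)

-- A lattice path with n steps: true = up-step (1,1), false = down-step (1,-1).
-- Paths start at the origin (height 0).
Path : ℕ → Set
Path n = Vec Bool n

δ : Bool → ℤ
δ true  = + 1
δ false = -[1+ 0 ]

_==_ : ℤ → ℤ → Bool
a == b = ⌊ a ℤ.≟ b ⌋

infix 4 _≤ᵇ_ _==_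
_≤ᵇ_ : ℤ → ℤ → Bool
a ≤ᵇ b = ⌊ a ℤ.≤? b ⌋

b2n : Bool → ℕ
b2n true  = 1
b2n false = 0

numUp : ∀ {n} → Path n → ℕ
numUp []       = 0
numUp (s ∷ x) = b2n s + numUp x

InL : (n m : ℕ) → Path n → Set
InL n m x = numUp x ≡ m

-- u_c, d_c computed along a path whose current starting height is h
upsFrom : ∀ {n} → ℤ → ℤ → Path n → ℕ
upsFrom c h []       = 0
upsFrom c h (s ∷ x) = b2n (s ∧ (h == c)) + upsFrom c (h +ℤ δ s) x

downsFrom : ∀ {n} → ℤ → ℤ → Path n → ℕ
downsFrom c h []       = 0
downsFrom c h (s ∷ x) = b2n (Data.Bool.not s ∧ (h == c)) + downsFrom c (h +ℤ δ s) x

u : ∀ {n} → ℤ → Path n → ℕ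
u c x = upsFrom c (+ 0) x

d : ∀ {n} → ℤ → Path n → ℕ
d c x = downsFrom c (+ 0) x

belowFrom : ∀ {n} → ℤ → Path n → ℕ
belowFrom h []       = 0
belowFrom h (s ∷ x) =
  b2n (Data.Bool.not s ∧ ((h ≤ᵇ + 0) ∧ ((h +ℤ δ s) ≤ᵇ + 0))) + belowFrom (h +ℤ δ s) x

downsBelow0 : ∀ {n} → Path n → ℕ
downsBelow0 x = belowFrom (+ 0) x

InD : (k e : ℕ) → Path (2 * k) → Set
InD k e x = InL (2 * k) k x × downsBelow0 x ≡ e

InLminusD0 : (k : ℕ) → Path (2 * k) → Set
InLminusD0 k x = InL (2 * k) k x × ¬ (downsBelow0 x ≡ 0)

touches : ℤ → ℤ → Bool → Bool
touches c h s = (h == c) ∨ ((h +ℤ δ s) == c)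

-- replace the j-th (1-based, from the left) step of kind `b` touching y = c by
-- a step of kind `not b`; h is the current starting height.  If there is no
-- such step (in particular if j = 0) the path is left unchanged.
replFrom : ∀ {n} → Bool → ℤ → ℕ → ℤ → Path n → Path n
replFrom b c j h [] = []
replFrom b c zero h (s ∷ x) = s ∷ x
replFrom b c (suc j) h (s ∷ x) with ⌊ s Data.Bool.≟ b ⌋ ∧ touches c h s
... | false = s ∷ replFrom b c (suc j) (h +ℤ δ s) x
... | true with j
...   | zero    = Data.Bool.not s ∷ x
...   | suc j'  = s ∷ replFrom b c (suc j') (h +ℤ δ s) x

hmap : ∀ {n} → Path n → Path n
hmap x = replFrom true (+ 1) (u (+ 1) x) (+ 0) x

g′ : ∀ {n} → Path n → Path n
g′ x = replFrom false (+ 0) (d (+ 0) x) (+ 0) x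

-- A path crosses the strip between the levels c and c + 1 alternately upwards
-- and downwards, so  u_c + [start > c] = d_{c+1} + [end > c].  A path x of
-- L_{2k,k+1} ends at height 2, hence u₁(x) = d₂(x) + 1 ≥ 1 and h really changes
-- a step.  Turning that up-step (starting at 0 or 1) into a down-step lowers the
-- rest of the path by 2, which turns its down-steps from 2 into down-steps from
-- 0; counting shows that d₀(h(x)) is exactly the position of the changed step
-- among the down-steps of h(x) touching y = 0, so g′ changes it back.
-- Symmetrically, a path y of L_{2k,k} ∖ D⁰ ends at 0 and has d₀(y) ≥ 1 (its
-- first step below 0 starts at 0); g′ raises the rest of y by 2, and the changed
-- step becomes the u₁-th up-step touching y = 1.  Both facts are proved by one
-- induction along the path, carrying the counts of the remaining suffix.
module Submission where

open import Defs
open import Data.Nat using (ℕ; _≥_; _*_; suc)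
open import Data.Product using (_×_)
open import Relation.Binary.PropositionalEquality using (_≡_)

open import Data.Bool using (true; false; not; _∧_)
open import Data.Empty using (⊥-elim)
open import Data.Integer using (ℤ; +_; -[1+_]; _<_) renaming (_+_ to _+ℤ_; _≤_ to _≤ℤ_)
open import Data.Integer.Properties
  using (_≟_; _<?_; <-cmp; <-irrefl; <-≤-trans; ≤⇒≯; ≤-reflexive; i≤i+j
        ; i<j⇒suc[i]≤j; suc[i]≤j⇒i<j)
import Data.Integer.Properties as ℤ
open import Data.Integer.Tactic.RingSolver using (solve-∀)
open import Data.Nat using (zero; pred; _+_; _≤_; z≤n; s≤s; ≢-nonZero)
import Data.Nat.Properties as ℕ
import Data.Nat.Tactic.RingSolver as ℕ-Solver
open import Data.Product using (_,_; proj₁)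
open import Data.Vec using ([]; _∷_)
open import Function using (_∘_)
open import Relation.Binary using (tri<; tri≈; tri>)
open import Relation.Binary.PropositionalEquality
  using (_≢_; refl; sym; trans; cong; cong₂; subst; module ≡-Reasoning)
open import Relation.Nullary using (Dec; yes; no; ¬_)
open import Relation.Nullary.Decidable using (⌊_⌋; isYes≗does; dec-true; dec-false)

open import Algebra.Properties.AbelianGroup ℤ.+-0-abelianGroup using (∙-cancelʳ)
open import Algebra.Properties.CommutativeSemigroup ℕ.+-commutativeSemigroup
  using (xy∙z≈y∙xz; x∙yz≈y∙xz)
open import Algebra.Properties.CommutativeSemigroup ℤ.+-commutativeSemigroup
  using (xy∙z≈xz∙y)

⌊⌋-true : ∀ {A : Set} (a? : Dec A) → A → ⌊ a? ⌋ ≡ true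
⌊⌋-true a? a = trans (isYes≗does a?) (dec-true a? a)

⌊⌋-false : ∀ {A : Set} (a? : Dec A) → ¬ A → ⌊ a? ⌋ ≡ false
⌊⌋-false a? ¬a = trans (isYes≗does a?) (dec-false a? ¬a)

==-+ʳ : ∀ h c t → (h +ℤ t == c +ℤ t) ≡ (h == c)
==-+ʳ h c t with h ≟ c
... | yes refl = ⌊⌋-true ((h +ℤ t) ≟ (h +ℤ t)) refl
... | no h≢c   = ⌊⌋-false ((h +ℤ t) ≟ (c +ℤ t)) (h≢c ∘ ∙-cancelʳ t h c)

i<i+1 : ∀ i → i < i +ℤ + 1
i<i+1 i = suc[i]≤j⇒i<j (≤-reflexive (ℤ.+-comm (+ 1) i))

i<j⇒i+1≤j : ∀ {i j} → i < j → i +ℤ + 1 ≤ℤ j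
i<j⇒i+1≤j {i} i<j = subst (_≤ℤ _) (ℤ.+-comm (+ 1) i) (i<j⇒suc[i]≤j i<j)

i-1+1≡i : ∀ i → (i +ℤ -[1+ 0 ]) +ℤ + 1 ≡ i
i-1+1≡i i = trans (ℤ.+-assoc i -[1+ 0 ] (+ 1)) (ℤ.+-identityʳ i)

above : ℤ → ℤ → ℕ
above c h = b2n ⌊ c <? h ⌋

above-suc : ∀ c h → b2n (h == c) + above c h ≡ above c (h +ℤ + 1)
above-suc c h with <-cmp c h
... | tri< c<h c≢h _
  rewrite ⌊⌋-false (h ≟ c) (c≢h ∘ sym) | ⌊⌋-true (c <? h) c<h
        | ⌊⌋-true (c <? h +ℤ + 1) (<-≤-trans c<h (i≤i+j h (+ 1))) = refl
... | tri≈ _ refl _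
  rewrite ⌊⌋-true (c ≟ c) refl | ⌊⌋-false (c <? c) (<-irrefl refl)
        | ⌊⌋-true (c <? c +ℤ + 1) (i<i+1 c) = refl
... | tri> c≮h c≢h h<c
  rewrite ⌊⌋-false (h ≟ c) (c≢h ∘ sym) | ⌊⌋-false (c <? h) c≮h
        | ⌊⌋-false (c <? h +ℤ + 1) (≤⇒≯ (i<j⇒i+1≤j h<c)) = refl

above-pred : ∀ c h → above c h ≡ b2n (h == c +ℤ + 1) + above c (h +ℤ -[1+ 0 ])
above-pred c h = begin
  above c h                                 ≡⟨ cong (above c) (i-1+1≡i h) ⟨
  above c (h′ +ℤ + 1)                       ≡⟨ above-suc c h′ ⟨
  b2n (h′ == c) + above c h′                ≡⟨ cong (λ b → b2n b + above c h′) (==-+ʳ h′ c (+ 1)) ⟨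
  b2n (h′ +ℤ + 1 == c +ℤ + 1) + above c h′  ≡⟨ cong (λ g → [ g ] + above c h′) (i-1+1≡i h) ⟩
  b2n (h == c +ℤ + 1) + above c h′          ∎
  where open ≡-Reasoning
        h′ = h +ℤ -[1+ 0 ]
        [_] = λ g → b2n (g == c +ℤ + 1)

endHeight : ∀ {n} → ℤ → Path n → ℤ
endHeight h []      = h
endHeight h (s ∷ x) = endHeight (h +ℤ δ s) x

crossing-balance : ∀ c {n} (w : Path n) h →
  upsFrom c h w + above c h ≡ downsFrom (c +ℤ + 1) h w + above c (endHeight h w)
crossing-balance c []          h = refl
crossing-balance c (true ∷ w)  h = begin
  b2n (h == c) + U + above c h    ≡⟨ xy∙z≈y∙xz (b2n (h == c)) U (above c h) ⟩
  U + (b2n (h == c) + above c h)  ≡⟨ cong (λ a → U + a) (above-suc c h) ⟩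
  U + above c (h +ℤ + 1)          ≡⟨ crossing-balance c w (h +ℤ + 1) ⟩
  _                               ∎
  where open ≡-Reasoning
        U = upsFrom c (h +ℤ + 1) w
crossing-balance c (false ∷ w) h = begin
  U + above c h                        ≡⟨ cong (λ a → U + a) (above-pred c h) ⟩
  U + (b + above c h′)                 ≡⟨ x∙yz≈y∙xz U b (above c h′) ⟩
  b + (U + above c h′)                 ≡⟨ cong (λ a → b + a) (crossing-balance c w h′) ⟩
  b + (D + above c (endHeight h′ w))   ≡⟨ ℕ.+-assoc b D _ ⟨
  b + D + above c (endHeight h′ w)     ∎
  where open ≡-Reasoning
        h′ = h +ℤ -[1+ 0 ]
        U = upsFrom c h′ w
        D = downsFrom (c +ℤ + 1) h′ w
        b = b2n (h == c +ℤ + 1)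

upsFrom-shift : ∀ c t {n} (w : Path n) h → upsFrom (c +ℤ t) (h +ℤ t) w ≡ upsFrom c h w
upsFrom-shift c t []      h = refl
upsFrom-shift c t (s ∷ w) h = cong₂ _+_
  (cong (λ b → b2n (s ∧ b)) (==-+ʳ h c t))
  (trans (cong (λ g → upsFrom (c +ℤ t) g w) (xy∙z≈xz∙y h t (δ s))) (upsFrom-shift c t w (h +ℤ δ s)))

downsFrom-shift : ∀ c t {n} (w : Path n) h → downsFrom (c +ℤ t) (h +ℤ t) w ≡ downsFrom c h w
downsFrom-shift c t []      h = refl
downsFrom-shift c t (s ∷ w) h = cong₂ _+_
  (cong (λ b → b2n (not s ∧ b)) (==-+ʳ h c t))
  (trans (cong (λ g → downsFrom (c +ℤ t) g w) (xy∙z≈xz∙y h t (δ s))) (downsFrom-shift c t w (h +ℤ δ s)))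

endHeight-numUp : ∀ {n} (x : Path n) h → endHeight h x +ℤ + n ≡ h +ℤ + (numUp x + numUp x)
endHeight-numUp []      h = refl
endHeight-numUp (s ∷ x) h = begin
  e +ℤ (+ 1 +ℤ + _)                       ≡⟨ +-pull-1 e (+ _) ⟩
  (e +ℤ + _) +ℤ + 1                       ≡⟨ cong (_+ℤ + 1) (endHeight-numUp x (h +ℤ δ s)) ⟩
  ((h +ℤ δ s) +ℤ (U +ℤ U)) +ℤ + 1         ≡⟨ regroup h (δ s) U ⟩
  h +ℤ ((δ s +ℤ + 1) +ℤ (U +ℤ U))         ≡⟨ cong (λ a → h +ℤ (a +ℤ (U +ℤ U))) (δ+1 s) ⟩
  h +ℤ ((+ b2n s +ℤ + b2n s) +ℤ (U +ℤ U)) ≡⟨ cong (h +ℤ_) (medial (+ b2n s) U) ⟩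
  h +ℤ ((+ b2n s +ℤ U) +ℤ (+ b2n s +ℤ U)) ∎
  where
  open ≡-Reasoning
  e = endHeight (h +ℤ δ s) x
  U = + numUp x
  δ+1 : ∀ s → δ s +ℤ + 1 ≡ + (b2n s + b2n s)
  δ+1 true  = refl
  δ+1 false = refl
  +-pull-1 : ∀ a b → a +ℤ (+ 1 +ℤ b) ≡ (a +ℤ b) +ℤ + 1
  +-pull-1 = solve-∀
  regroup : ∀ a d u → ((a +ℤ d) +ℤ (u +ℤ u)) +ℤ + 1 ≡ a +ℤ ((d +ℤ + 1) +ℤ (u +ℤ u))
  regroup = solve-∀
  medial : ∀ b u → (b +ℤ b) +ℤ (u +ℤ u) ≡ (b +ℤ u) +ℤ (b +ℤ u)
  medial = solve-∀

InL⇒endHeight : ∀ k e (x : Path (2 * k)) → InL (2 * k) (e + k) x → endHeight (+ 0) x ≡ + (e + e)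
InL⇒endHeight k e x x∈L = ∙-cancelʳ (+ (2 * k)) _ _ (begin
  endHeight (+ 0) x +ℤ + (2 * k)  ≡⟨ endHeight-numUp x (+ 0) ⟩
  + (numUp x + numUp x)           ≡⟨ cong (λ a → + (a + a)) x∈L ⟩
  + ((e + k) + (e + k))           ≡⟨ cong +_ (regroup e k) ⟩
  + (e + e) +ℤ + (2 * k)          ∎)
  where
  open ≡-Reasoning
  regroup : ∀ e k → (e + k) + (e + k) ≡ (e + e) + 2 * k
  regroup = ℕ-Solver.solve-∀

downsFrom0≤belowFrom : ∀ {n} (w : Path n) h → downsFrom (+ 0) h w ≤ belowFrom h w
downsFrom0≤belowFrom []          h = z≤n
downsFrom0≤belowFrom (true ∷ w)  h = downsFrom0≤belowFrom w (h +ℤ + 1)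
downsFrom0≤belowFrom (false ∷ w) h = ℕ.+-mono-≤ (step h) (downsFrom0≤belowFrom w (h +ℤ -[1+ 0 ]))
  where
  step : ∀ h → b2n (h == + 0) ≤ b2n ((h ≤ᵇ + 0) ∧ (h +ℤ -[1+ 0 ] ≤ᵇ + 0))
  step (+ zero)  = s≤s z≤n
  step (+ suc _) = z≤n
  step -[1+ _ ]  = z≤n

downsFrom0≢0⇒belowFrom≢0 : ∀ {n} (w : Path n) h → downsFrom (+ 0) h w ≢ 0 → belowFrom h w ≢ 0
downsFrom0≢0⇒belowFrom≢0 w h d≢0 b≡0 =
  d≢0 (ℕ.n≤0⇒n≡0 (subst (downsFrom (+ 0) h w ≤_) b≡0 (downsFrom0≤belowFrom w h)))

belowFrom≢0⇒downsFrom0≢0 : ∀ {n} (w : Path n) k → belowFrom (+ k) w ≢ 0 → downsFrom (+ 0) (+ k) w ≢ 0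
belowFrom≢0⇒downsFrom0≢0 []          k       b≢0 = b≢0
belowFrom≢0⇒downsFrom0≢0 (true ∷ w)  k       b≢0 = belowFrom≢0⇒downsFrom0≢0 w (k + 1) b≢0
belowFrom≢0⇒downsFrom0≢0 (false ∷ w) zero    b≢0 = λ ()
belowFrom≢0⇒downsFrom0≢0 (false ∷ w) (suc k) b≢0 = belowFrom≢0⇒downsFrom0≢0 w k b≢0

-- z′ and z are suffixes, walked from height h, of a path after and before the
-- replacement; m is the offset between the counts on these suffixes, 0 for
-- whole paths.
record DownReplRestores {n} (h : ℤ) (m : ℕ) (z′ z : Path n) : Set where
  constructor restoredBy
  field
    index   : ℕ
    downs0  : downsFrom (+ 0) h z′ ≡ m + suc index
    restore : replFrom false (+ 0) (suc index) h z′ ≡ z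
    numUp≡  : suc (numUp z′) ≡ numUp z

record UpReplRestores {n} (h : ℤ) (m : ℕ) (z′ z : Path n) : Set where
  constructor restoredBy
  field
    index   : ℕ
    ups1    : upsFrom (+ 1) h z′ ≡ above (+ 0) h + (m + suc index)
    restore : replFrom true (+ 1) (suc index) h z′ ≡ z
    numUp≡  : numUp z′ ≡ suc (numUp z)

lowered-downsFrom0 : ∀ {n} (z : Path n) h → endHeight h z ≡ + 2 →
  upsFrom (+ 1) h z + above (+ 1) h ≡ downsFrom (+ 0) (h +ℤ -[1+ 1 ]) z + 1
lowered-downsFrom0 z h e = begin
  upsFrom (+ 1) h z + above (+ 1) h                   ≡⟨ crossing-balance (+ 1) z h ⟩
  downsFrom (+ 2) h z + above (+ 1) (endHeight h z)   ≡⟨ cong₂ (λ a b → a + above (+ 1) b) shift e ⟩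
  downsFrom (+ 0) (h +ℤ -[1+ 1 ]) z + 1               ∎
  where open ≡-Reasoning
        shift = sym (downsFrom-shift (+ 2) -[1+ 1 ] z h)

raised-upsFrom1 : ∀ {n} (z : Path n) h → endHeight h z ≡ + 0 →
  upsFrom (+ 1) (h +ℤ + 2) z + above -[1+ 0 ] h ≡ downsFrom (+ 0) h z + 1
raised-upsFrom1 z h e = begin
  upsFrom (+ 1) (h +ℤ + 2) z + above -[1+ 0 ] h  ≡⟨ cong (_+ above -[1+ 0 ] h) shift ⟩
  upsFrom -[1+ 0 ] h z + above -[1+ 0 ] h        ≡⟨ crossing-balance -[1+ 0 ] z h ⟩
  D + above -[1+ 0 ] (endHeight h z)             ≡⟨ cong (λ b → D + above -[1+ 0 ] b) e ⟩
  D + 1                                          ∎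
  where open ≡-Reasoning
        shift = upsFrom-shift -[1+ 0 ] (+ 2) z h
        D = downsFrom (+ 0) h z

replaced-up-from-0 : ∀ {n} (z : Path n) m → upsFrom (+ 1) (+ 1) z ≡ m + 1 → endHeight (+ 1) z ≡ + 2 →
  DownReplRestores (+ 0) m (false ∷ z) (true ∷ z)
replaced-up-from-0 z m ups e = restoredBy 0 downs refl refl
  where
  open ≡-Reasoning
  D = downsFrom (+ 0) -[1+ 0 ] z
  downs : suc D ≡ m + 1
  downs = begin
    suc D                      ≡⟨ ℕ.+-comm 1 D ⟩
    D + 1                      ≡⟨ lowered-downsFrom0 z (+ 1) e ⟨
    upsFrom (+ 1) (+ 1) z + 0  ≡⟨ ℕ.+-identityʳ _ ⟩
    upsFrom (+ 1) (+ 1) z      ≡⟨ ups ⟩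
    m + 1                      ∎

replaced-up-from-1 : ∀ {n} (z : Path n) m → upsFrom (+ 1) (+ 2) z ≡ m + 1 → endHeight (+ 2) z ≡ + 2 →
  DownReplRestores (+ 1) m (false ∷ z) (true ∷ z)
replaced-up-from-1 z m ups e =
  restoredBy 0 (trans (sym (ℕ.+-cancelʳ-≡ 1 _ _ (lowered-downsFrom0 z (+ 2) e))) ups) refl refl

replaced-down-from-0 : ∀ {n} (z : Path n) m →
  suc (downsFrom (+ 0) -[1+ 0 ] z) ≡ m + 1 → endHeight -[1+ 0 ] z ≡ + 0 →
  UpReplRestores (+ 0) m (true ∷ z) (false ∷ z)
replaced-down-from-0 z m downs e = restoredBy 0 ups refl refl
  where
  open ≡-Reasoning
  U = upsFrom (+ 1) (+ 1) z
  D = downsFrom (+ 0) -[1+ 0 ] z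
  ups : U ≡ m + 1
  ups = begin
    U        ≡⟨ ℕ.+-identityʳ U ⟨
    U + 0    ≡⟨ raised-upsFrom1 z -[1+ 0 ] e ⟩
    D + 1    ≡⟨ ℕ.+-comm D 1 ⟩
    suc D    ≡⟨ downs ⟩
    m + 1    ∎

replaced-down-from-1 : ∀ {n} (z : Path n) m → downsFrom (+ 0) (+ 0) z ≡ m + 1 → endHeight (+ 0) z ≡ + 0 →
  UpReplRestores (+ 1) m (true ∷ z) (false ∷ z)
replaced-down-from-1 z m downs e =
  restoredBy 0 (cong suc (trans (ℕ.+-cancelʳ-≡ 1 _ _ (raised-upsFrom1 z (+ 0) e)) downs)) refl refl

upRepl-restored : ∀ {n} (z : Path n) h j m →
  upsFrom (+ 1) h z ≡ above (+ 0) h + (m + suc j) → endHeight h z ≡ + 2 →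
  DownReplRestores h m (replFrom true (+ 1) (suc j) h z) z
upRepl-restored [] h j m ups e = ⊥-elim (ℕ.m+1+n≢0 m (ℕ.m+n≡0⇒n≡0 (above (+ 0) h) (sym ups)))
upRepl-restored (false ∷ z) (+ 0) j m ups e with upRepl-restored z -[1+ 0 ] j m ups e
... | restoredBy i d r nu =
  restoredBy (suc i) (trans (cong suc d) (sym (ℕ.+-suc m (suc i)))) (cong (false ∷_) r) nu
upRepl-restored (false ∷ z) (+ 1) j m ups e with upRepl-restored z (+ 0) j (suc m) ups e
... | restoredBy i d r nu = restoredBy (suc i) (trans d (sym (ℕ.+-suc m (suc i)))) (cong (false ∷_) r) nu
upRepl-restored (false ∷ z) (+ suc (suc k)) j m ups e with upRepl-restored z (+ suc k) j m ups e
... | restoredBy i d r nu = restoredBy i d (cong (false ∷_) r) nu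
upRepl-restored (false ∷ z) -[1+ k ] j m ups e with upRepl-restored z (-[1+ k ] +ℤ -[1+ 0 ]) j m ups e
... | restoredBy i d r nu = restoredBy i d (cong (false ∷_) r) nu
upRepl-restored (true ∷ z) (+ 0) zero m ups e = replaced-up-from-0 z m ups e
upRepl-restored (true ∷ z) (+ 0) (suc j) m ups e
  with upRepl-restored z (+ 1) j m (trans ups (ℕ.+-suc m (suc j))) e
... | restoredBy i d r nu = restoredBy i d (cong (true ∷_) r) (cong suc nu)
upRepl-restored (true ∷ z) (+ 1) zero m ups e = replaced-up-from-1 z m (ℕ.suc-injective ups) e
upRepl-restored (true ∷ z) (+ 1) (suc j) m ups e
  with upRepl-restored z (+ 2) j m (trans (ℕ.suc-injective ups) (ℕ.+-suc m (suc j))) e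
... | restoredBy i d r nu = restoredBy i d (cong (true ∷_) r) (cong suc nu)
upRepl-restored (true ∷ z) (+ suc (suc k)) j m ups e with upRepl-restored z (+ suc (suc k) +ℤ + 1) j m ups e
... | restoredBy i d r nu = restoredBy i d (cong (true ∷_) r) (cong suc nu)
upRepl-restored (true ∷ z) -[1+ 0 ] j m ups e with upRepl-restored z (+ 0) j m ups e
... | restoredBy i d r nu = restoredBy i d (cong (true ∷_) r) (cong suc nu)
upRepl-restored (true ∷ z) -[1+ suc k ] j m ups e with upRepl-restored z -[1+ k ] j m ups e
... | restoredBy i d r nu = restoredBy i d (cong (true ∷_) r) (cong suc nu)

downRepl-restored : ∀ {n} (z : Path n) h j m →
  downsFrom (+ 0) h z ≡ m + suc j → endHeight h z ≡ + 0 →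
  UpReplRestores h m (replFrom false (+ 0) (suc j) h z) z
downRepl-restored [] h j m downs e = ⊥-elim (ℕ.m+1+n≢0 m (sym downs))
downRepl-restored (true ∷ z) (+ 0) j m downs e with downRepl-restored z (+ 1) j m downs e
... | restoredBy i u r nu =
  restoredBy (suc i) (trans u (sym (ℕ.+-suc m (suc i)))) (cong (true ∷_) r) (cong suc nu)
downRepl-restored (true ∷ z) (+ 1) j m downs e with downRepl-restored z (+ 2) j m downs e
... | restoredBy i u r nu =
  restoredBy (suc i) (cong suc (trans u (sym (ℕ.+-suc m (suc i))))) (cong (true ∷_) r) (cong suc nu)
downRepl-restored (true ∷ z) (+ suc (suc k)) j m downs e
  with downRepl-restored z (+ suc (suc k) +ℤ + 1) j m downs e
... | restoredBy i u r nu = restoredBy i u (cong (true ∷_) r) (cong suc nu)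
downRepl-restored (true ∷ z) -[1+ 0 ] j m downs e with downRepl-restored z (+ 0) j m downs e
... | restoredBy i u r nu = restoredBy i u (cong (true ∷_) r) (cong suc nu)
downRepl-restored (true ∷ z) -[1+ suc k ] j m downs e with downRepl-restored z -[1+ k ] j m downs e
... | restoredBy i u r nu = restoredBy i u (cong (true ∷_) r) (cong suc nu)
downRepl-restored (false ∷ z) (+ 0) zero m downs e = replaced-down-from-0 z m downs e
downRepl-restored (false ∷ z) (+ 0) (suc j) m downs e
  with downRepl-restored z -[1+ 0 ] j m (ℕ.suc-injective (trans downs (ℕ.+-suc m (suc j)))) e
... | restoredBy i u r nu = restoredBy i u (cong (false ∷_) r) nu
downRepl-restored (false ∷ z) (+ 1) zero m downs e = replaced-down-from-1 z m downs e
downRepl-restored (false ∷ z) (+ 1) (suc j) m downs e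
  with downRepl-restored z (+ 0) j (suc m) (trans downs (ℕ.+-suc m (suc j))) e
... | restoredBy i u r nu = restoredBy i u (cong (false ∷_) r) nu
downRepl-restored (false ∷ z) (+ suc (suc k)) j m downs e with downRepl-restored z (+ suc k) j m downs e
... | restoredBy i u r nu = restoredBy i u (cong (false ∷_) r) nu
downRepl-restored (false ∷ z) -[1+ k ] j m downs e
  with downRepl-restored z (-[1+ k ] +ℤ -[1+ 0 ]) j m downs e
... | restoredBy i u r nu = restoredBy i u (cong (false ∷_) r) nu

hmap-restored : ∀ {n} (x : Path n) → endHeight (+ 0) x ≡ + 2 → DownReplRestores (+ 0) 0 (hmap x) x
hmap-restored x e = subst (λ j → DownReplRestores (+ 0) 0 (replFrom true (+ 1) j (+ 0) x) x)
                          (sym u₁≡) (upRepl-restored x (+ 0) D 0 u₁≡ e)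
  where
  open ≡-Reasoning
  D = downsFrom (+ 2) (+ 0) x
  u₁≡ : u (+ 1) x ≡ suc D
  u₁≡ = begin
    u (+ 1) x                            ≡⟨ ℕ.+-identityʳ _ ⟨
    u (+ 1) x + 0                        ≡⟨ crossing-balance (+ 1) x (+ 0) ⟩
    D + above (+ 1) (endHeight (+ 0) x)  ≡⟨ cong (λ b → D + above (+ 1) b) e ⟩
    D + 1                                ≡⟨ ℕ.+-comm D 1 ⟩
    suc D                                ∎

g′-restored : ∀ {n} (y : Path n) → d (+ 0) y ≢ 0 → endHeight (+ 0) y ≡ + 0 →
  UpReplRestores (+ 0) 0 (g′ y) y
g′-restored y d≢0 e = subst (λ j → UpReplRestores (+ 0) 0 (replFrom false (+ 0) j (+ 0) y) y)
                            d₀≡ (downRepl-restored y (+ 0) (pred (d (+ 0) y)) 0 (sym d₀≡) e)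
  where
  d₀≡ : suc (pred (d (+ 0) y)) ≡ d (+ 0) y
  d₀≡ = ℕ.suc-pred _ ⦃ ≢-nonZero d≢0 ⦄

g′-inverts : ∀ {n} {y x : Path n} → DownReplRestores (+ 0) 0 y x → g′ y ≡ x
g′-inverts {y = y} (restoredBy _ downs restore _) =
  trans (cong (λ j → replFrom false (+ 0) j (+ 0) y) downs) restore

hmap-inverts : ∀ {n} {y x : Path n} → UpReplRestores (+ 0) 0 y x → hmap y ≡ x
hmap-inverts {y = y} (restoredBy _ ups restore _) =
  trans (cong (λ j → replFrom true (+ 1) j (+ 0) y) ups) restore

lemma7 : (k : ℕ) → k ≥ 1 →
    ((x : Path (2 * k)) → InL (2 * k) (suc k) x → InLminusD0 k (hmap x))
    × ((y : Path (2 * k)) → InLminusD0 k y → InL (2 * k) (suc k) (g′ y))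
    × ((x : Path (2 * k)) → InL (2 * k) (suc k) x → g′ (hmap x) ≡ x)
    × ((y : Path (2 * k)) → InLminusD0 k y → hmap (g′ y) ≡ y)
lemma7 k _ =
  hmap-into , g′-into , (λ x → g′-inverts ∘ hmap-restores x) , (λ y → hmap-inverts ∘ g′-restores y)
  where
  hmap-restores : ∀ x → InL (2 * k) (suc k) x → DownReplRestores (+ 0) 0 (hmap x) x
  hmap-restores x x∈L = hmap-restored x (InL⇒endHeight k 1 x x∈L)

  g′-restores : ∀ y → InLminusD0 k y → UpReplRestores (+ 0) 0 (g′ y) y
  g′-restores y (y∈L , y∉D₀) =
    g′-restored y (belowFrom≢0⇒downsFrom0≢0 y 0 y∉D₀) (InL⇒endHeight k 0 y y∈L)

  hmap-into : ∀ x → InL (2 * k) (suc k) x → InLminusD0 k (hmap x)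
  hmap-into x x∈L with hmap-restores x x∈L
  ... | restoredBy _ downs _ numUp≡ =
    ℕ.suc-injective (trans numUp≡ x∈L) ,
    downsFrom0≢0⇒belowFrom≢0 (hmap x) (+ 0) (ℕ.1+n≢0 ∘ trans (sym downs))

  g′-into : ∀ y → InLminusD0 k y → InL (2 * k) (suc k) (g′ y)
  g′-into y y∈ with g′-restores y y∈
  ... | restoredBy _ _ _ numUp≡ = trans numUp≡ (cong suc (proj₁ y∈))
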